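{- Let $j$ be a positive divisor of $6$ and let $n$ be a positive integer. Among the positive divisors $d$ of $n$ with $\gcd(d,6)=j$, at most $\frac12\tau'_j(n)$ of them satisfy $d>\sqrt{jn}$.
   Context: For $j\mid 6$, $\tau'_j(n)$ is the number of positive divisors $d$ of $n$ with $\gcd(d,6)=j$. -}

module Defs where

open import Data.Nat using (ℕ; suc; _*_; _<_; _<?_)
open import Data.Nat.Properties using (_≟_)
open import Data.Nat.Divisibility using (_∣?_)
open import Data.Nat.GCD using (gcd)
open import Data.List using (List; filter; length; upTo; map)

divisors : ℕ → List ℕ
divisors n = filter (λ d → d ∣? n) (map suc (upTo n))

divisorsWithGcd : ℕ → ℕ → List ℕ
divisorsWithGcd j n = filter (λ d → gcd d 6 ≟ j) (divisors n)

τ′ : ℕ → ℕ → ℕ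
τ′ j n = length (divisorsWithGcd j n)

-- number of such divisors with d > √(j n), i.e. d * d > j * n
bigCount : ℕ → ℕ → ℕ
bigCount j n = length (filter (λ d → (j * n) <? (d * d)) (divisorsWithGcd j n))

{-# OPTIONS --safe #-}
module Submission where

-- Let r = 6/j and let m be the largest divisor of n coprime to r. As 6 is squarefree, j and r
-- are coprime, so every divisor d of n with gcd(d,6) = j divides m; and as gcd(m,6) ∣ j, the
-- cofactor jm/d is again such a divisor. The map d ↦ jm/d is injective and sends each d with
-- d² > jn ≥ jm to some e with e² < jm ≤ jn, so at most half of these divisors exceed √(jn).

open import Defs
open import Data.Nat
  using (ℕ; zero; suc; _+_; _*_; _≤_; _<_; _<?_; _≤?_; z≤n; s≤s
        ; NonZero; NonTrivial; n>1⇒nonTrivial; ≢-nonZero; ≢-nonZero⁻¹)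
open import Data.Nat.Properties
open import Data.Nat.Divisibility
open import Data.Nat.DivMod using (_/_; m/n*n≡m)
open import Data.Nat.GCD using (gcd; gcd[m,n]∣m; gcd[m,n]∣n; gcd-greatest; gcd[m,n]≢0)
open import Data.Nat.Coprimality using (Coprime; coprime-divisor; gcd≡1⇒coprime)
open import Data.Nat.Induction using (<-wellFounded)
open import Induction.WellFounded using (Acc; acc)
open import Data.List using (List; []; _∷_; _++_; filter; length; map; upTo)
open import Data.List.Properties using (length-map; length-++; length-removeAt′)
open import Data.List.Membership.Propositional using (_∈_; _─_)
open import Data.List.Membership.Propositional.Properties
  using (∈-filter⁺; ∈-filter⁻; ∈-map⁺; ∈-map⁻; ∈-upTo⁺; ∈-++⁻)
open import Data.List.Relation.Unary.Any using (here; there)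
open import Data.List.Relation.Unary.All as All using ()
open import Data.List.Relation.Unary.All.Properties as All using ()
open import Data.List.Relation.Unary.AllPairs using ([]; _∷_)
open import Data.List.Relation.Unary.Unique.Propositional using (Unique)
import Data.List.Relation.Unary.Unique.Propositional.Properties as Unique
open import Data.List.Relation.Binary.Subset.Propositional using (_⊆_)
open import Data.List.Relation.Binary.Disjoint.Propositional using (Disjoint)
open import Function using (_∘′_)
open import Data.Product using (_×_; _,_; proj₁; proj₂)
open import Data.Sum using (inj₁; inj₂)
open import Relation.Nullary using (yes; no)
open import Relation.Nullary.Decidable using (from-no)
open import Relation.Nullary.Negation using (contradiction)
open import Relation.Binary.PropositionalEquality
  using (_≡_; _≢_; ≢-sym; refl; sym; trans; cong; subst; subst₂)

module _ {A : Set} where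

  ∈-─ : ∀ {x z : A} {ys} (x∈ys : x ∈ ys) → z ∈ ys → z ≢ x → z ∈ ys ─ x∈ys
  ∈-─ (here refl) (here refl) z≢x = contradiction refl z≢x
  ∈-─ (here refl) (there z∈ys) _ = z∈ys
  ∈-─ (there _) (here refl) _ = here refl
  ∈-─ (there x∈ys) (there z∈ys) z≢x = there (∈-─ x∈ys z∈ys z≢x)

  Unique⇒length-mono : ∀ {xs ys : List A} → Unique xs → xs ⊆ ys → length xs ≤ length ys
  Unique⇒length-mono {[]} _ _ = z≤n
  Unique⇒length-mono {x ∷ xs} {ys} (x∉xs ∷ !xs) x∷xs⊆ys = begin
    suc (length xs)          ≤⟨ s≤s (Unique⇒length-mono !xs xs⊆ys─x) ⟩
    suc (length (ys ─ x∈ys)) ≡⟨ length-removeAt′ ys _ ⟨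
    length ys                ∎
    where
    open ≤-Reasoning
    x∈ys : x ∈ ys
    x∈ys = x∷xs⊆ys (here refl)
    xs⊆ys─x : xs ⊆ ys ─ x∈ys
    xs⊆ys─x z∈xs = ∈-─ x∈ys (x∷xs⊆ys (there z∈xs)) (≢-sym (All.lookup x∉xs z∈xs))

  map⁺-injectiveOn : ∀ {B : Set} {f : A → B} {xs} →
    (∀ {x y} → x ∈ xs → y ∈ xs → f x ≡ f y → x ≡ y) → Unique xs → Unique (map f xs)
  map⁺-injectiveOn _ [] = []
  map⁺-injectiveOn inj (x∉xs ∷ !xs) =
    All.map⁺ (All.tabulate λ y∈xs → All.lookup x∉xs y∈xs ∘′ inj (here refl) (there y∈xs))
    ∷ map⁺-injectiveOn (λ x∈xs y∈xs → inj (there x∈xs) (there y∈xs)) !xs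

cofactor-unique : ∀ {N a b c} .{{_ : NonZero N}} → c * a ≡ N → c * b ≡ N → a ≡ b
cofactor-unique {a = a} {b} {c} {{N≢0}} ca≡N cb≡N =
  *-cancelˡ-≡ a b c {{m*n≢0⇒m≢0 c {{subst NonZero (sym ca≡N) N≢0}}}} (trans ca≡N (sym cb≡N))

cofactor-below-√ : ∀ {e d K} → e * d ≤ K → K < d * d → e * e ≤ K
cofactor-below-√ {e} {d} {K} ed≤K K<dd = begin
  e * e ≤⟨ *-monoʳ-≤ e (<⇒≤ e<d) ⟩
  e * d ≤⟨ ed≤K ⟩
  K     ∎
  where
  open ≤-Reasoning
  e<d : e < d
  e<d = *-cancelʳ-< d e d (≤-<-trans ed≤K K<dd)

at-most-half-exceed-√ : ∀ {N K} .{{_ : NonZero N}} → N ≤ K → (f : ℕ → ℕ) → {S : List ℕ} → Unique S →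
  (∀ {d} → d ∈ S → f d ∈ S × f d * d ≡ N) →
  2 * length (filter (λ d → K <? d * d) S) ≤ length S
at-most-half-exceed-√ {N} {K} N≤K f {S} !S paired = begin
  2 * length B                ≡⟨ cong (length B +_) (trans (+-identityʳ _) (sym (length-map f B))) ⟩
  length B + length (map f B) ≡⟨ length-++ B ⟨
  length (B ++ map f B)       ≤⟨ Unique⇒length-mono !B++fB B++fB⊆S ⟩
  length S                    ∎
  where
  open ≤-Reasoning
  B : List ℕ
  B = filter (λ d → K <? d * d) S

  B⊆S : B ⊆ S
  B⊆S = proj₁ ∘′ ∈-filter⁻ (λ d → K <? d * d) {xs = S}

  exceeds : ∀ {d} → d ∈ B → K < d * d
  exceeds = proj₂ ∘′ ∈-filter⁻ (λ d → K <? d * d) {xs = S}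

  f-inj : ∀ {x y} → x ∈ B → y ∈ B → f x ≡ f y → x ≡ y
  f-inj {x} {y} x∈B y∈B fx≡fy = cofactor-unique {c = f x}
    (proj₂ (paired (B⊆S x∈B)))
    (subst (λ c → c * y ≡ N) (sym fx≡fy) (proj₂ (paired (B⊆S y∈B))))

  B∩fB=∅ : Disjoint B (map f B)
  B∩fB=∅ (e∈B , e∈fB) with ∈-map⁻ f e∈fB
  ... | d , d∈B , refl = <⇒≱ (exceeds e∈B)
    (cofactor-below-√ {f d} {d} (≤-trans (≤-reflexive (proj₂ (paired (B⊆S d∈B)))) N≤K) (exceeds d∈B))

  !B++fB : Unique (B ++ map f B)
  !B++fB = Unique.++⁺ !B (map⁺-injectiveOn f-inj !B) B∩fB=∅
    where
    !B : Unique B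
    !B = Unique.filter⁺ (λ d → K <? d * d) !S

  B++fB⊆S : B ++ map f B ⊆ S
  B++fB⊆S e∈ with ∈-++⁻ B e∈
  ... | inj₁ e∈B = B⊆S e∈B
  ... | inj₂ e∈fB with ∈-map⁻ f e∈fB
  ...   | d , d∈B , refl = proj₁ (paired (B⊆S d∈B))

coprime-∣ : ∀ {m n m′ n′} → Coprime m n → m′ ∣ m → n′ ∣ n → Coprime m′ n′
coprime-∣ m⊥n m′∣m n′∣n (i∣m′ , i∣n′) = m⊥n (∣-trans i∣m′ m′∣m , ∣-trans i∣n′ n′∣n)

record CoprimePart (r n : ℕ) : Set where
  field
    part          : ℕ
    part∣n        : part ∣ n
    part-coprime  : Coprime part r
    part-greatest : ∀ {d} → d ∣ n → Coprime d r → d ∣ part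

coprimePart : ∀ r n .{{_ : NonZero n}} → CoprimePart r n
coprimePart r n = go n (<-wellFounded n)
  where
  go : ∀ n .{{_ : NonZero n}} → Acc _<_ n → CoprimePart r n
  go n (acc smaller) with gcd n r ≟ 1
  ... | yes g≡1 = record
    { part = n ; part∣n = ∣-refl ; part-coprime = gcd≡1⇒coprime g≡1 ; part-greatest = λ d∣n _ → d∣n }
  ... | no g≢1 = record
    { part = part
    ; part∣n = ∣-trans part∣n (quotient-∣ g∣n)
    ; part-coprime = part-coprime
    ; part-greatest = λ d∣n d⊥r → part-greatest
        (coprime-divisor (coprime-∣ d⊥r ∣-refl (gcd[m,n]∣n n r)) (subst (_ ∣_) (m∣n⇒n≡m*quotient g∣n) d∣n))
        d⊥r
    }
    where
    -- a divisor of n = g · (n / g) coprime to r is coprime to g = gcd n r, so it divides n / g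
    g∣n : gcd n r ∣ n
    g∣n = gcd[m,n]∣m n r
    instance
      _ : NonTrivial (gcd n r)
      _ = n>1⇒nonTrivial (≤∧≢⇒< (n≢0⇒n>0 (gcd[m,n]≢0 n r (inj₁ (≢-nonZero⁻¹ n)))) (≢-sym g≢1))
    open CoprimePart (go (quotient g∣n) {{quotient≢0 g∣n}} (smaller (quotient-< g∣n)))

SquareFree : ℕ → Set
SquareFree n = ∀ {k} → k * k ∣ n → k ≡ 1

squareFree-6 : SquareFree 6
squareFree-6 {0} 0∣6 = contradiction 0∣6 (from-no (0 ∣? 6))
squareFree-6 {1} _ = refl
squareFree-6 {2} 4∣6 = contradiction 4∣6 (from-no (4 ∣? 6))
squareFree-6 {suc (suc (suc k))} k²∣6 =
  contradiction (≤-trans (*-mono-≤ 3≤k+3 3≤k+3) (∣⇒≤ k²∣6)) (from-no (9 ≤? 6))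
  where
  3≤k+3 : 3 ≤ suc (suc (suc k))
  3≤k+3 = s≤s (s≤s (s≤s z≤n))

squareFree⇒coprime : ∀ {m n} → SquareFree (m * n) → Coprime m n
squareFree⇒coprime sf (k∣m , k∣n) = sf (*-pres-∣ k∣m k∣n)

∣-nonZero : ∀ {m n} .{{_ : NonZero n}} → m ∣ n → NonZero m
∣-nonZero {n = n} m∣n = ≢-nonZero λ { refl → ≢-nonZero⁻¹ n (0∣⇒≡0 m∣n) }

coprime⇒gcd∣ : ∀ {m r j N} → Coprime m r → N ≡ r * j → gcd m N ∣ j
coprime⇒gcd∣ {m} {N = N} m⊥r N≡r*j = coprime-divisor
  (coprime-∣ m⊥r (gcd[m,n]∣m m N) ∣-refl) (subst (gcd m N ∣_) N≡r*j (gcd[m,n]∣n m N))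

gcd≡⇒coprime : ∀ {d N j r} → Coprime r j → r ∣ N → gcd d N ≡ j → Coprime d r
gcd≡⇒coprime r⊥j r∣N gcd≡j (k∣d , k∣r) =
  r⊥j (k∣r , subst (_ ∣_) gcd≡j (gcd-greatest k∣d (∣-trans k∣r r∣N)))

gcd-pinned : ∀ {N j m x} → j ∣ N → gcd m N ∣ j → j ∣ x → x ∣ m → gcd x N ≡ j
gcd-pinned {N} {x = x} j∣N gcd[m,N]∣j j∣x x∣m = ∣-antisym
  (∣-trans (gcd-greatest (∣-trans (gcd[m,n]∣m x N) x∣m) (gcd[m,n]∣n x N)) gcd[m,N]∣j)
  (gcd-greatest j∣x j∣N)

-- m / d, extended by the junk value 0 at d = 0
cofactor : ℕ → ℕ → ℕ
cofactor m zero      = zero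
cofactor m d@(suc _) = m / d

cofactor-* : ∀ {m d} .{{_ : NonZero d}} → d ∣ m → cofactor m d * d ≡ m
cofactor-* {d = suc _} = m/n*n≡m

*cofactor-* : ∀ j {m d} .{{_ : NonZero d}} → d ∣ m → j * cofactor m d * d ≡ j * m
*cofactor-* j {m} {d} d∣m = trans (*-assoc j (cofactor m d) d) (cong (j *_) (cofactor-* d∣m))

*cofactor∣ : ∀ {j m d} .{{_ : NonZero d}} → j ∣ d → d ∣ m → j * cofactor m d ∣ m
*cofactor∣ {j} {m} {d} j∣d d∣m =
  subst₂ _∣_ (*-comm (cofactor m d) j) (cofactor-* d∣m) (*-monoʳ-∣ (cofactor m d) j∣d)

∈-divisorsWithGcd⁻ : ∀ {j n d} → d ∈ divisorsWithGcd j n → d ∣ n × gcd d 6 ≡ j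
∈-divisorsWithGcd⁻ {j} {n} d∈ =
  let d∈divisors , gcd≡j = ∈-filter⁻ (λ d → gcd d 6 ≟ j) {xs = divisors n} d∈
  in proj₂ (∈-filter⁻ (_∣? n) {xs = map suc (upTo n)} d∈divisors) , gcd≡j

∈-divisorsWithGcd⁺ : ∀ {j n d} .{{_ : NonZero n}} → d ∣ n → gcd d 6 ≡ j → d ∈ divisorsWithGcd j n
∈-divisorsWithGcd⁺ {n = n} {zero} 0∣n _ = contradiction (0∣⇒≡0 0∣n) (≢-nonZero⁻¹ n)
∈-divisorsWithGcd⁺ {j} {n} {suc _} d∣n gcd≡j = ∈-filter⁺ (λ d → gcd d 6 ≟ j)
  (∈-filter⁺ (_∣? n) (∈-map⁺ suc (∈-upTo⁺ (∣⇒≤ d∣n))) d∣n) gcd≡j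

divisorsWithGcd-unique : ∀ j n → Unique (divisorsWithGcd j n)
divisorsWithGcd-unique j n =
  Unique.filter⁺ _ (Unique.filter⁺ _ (Unique.map⁺ suc-injective (Unique.upTo⁺ n)))

cofactor-∈-divisorsWithGcd : ∀ {j m n d} .{{_ : NonZero n}} .{{_ : NonZero d}} →
  j ∣ 6 → m ∣ n → gcd m 6 ∣ j → gcd d 6 ≡ j → d ∣ m → j * cofactor m d ∈ divisorsWithGcd j n
cofactor-∈-divisorsWithGcd {j} {m} {d = d} j∣6 m∣n gcd[m,6]∣j gcd[d,6]≡j d∣m =
  ∈-divisorsWithGcd⁺ (∣-trans e∣m m∣n) (gcd-pinned j∣6 gcd[m,6]∣j (m∣m*n _) e∣m)
  where
  e∣m : j * cofactor m d ∣ m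
  e∣m = *cofactor∣ (subst (_∣ d) gcd[d,6]≡j (gcd[m,n]∣m d 6)) d∣m

lemma7p2 : (j n : ℕ) → j ∣ 6 → .{{_ : NonZero n}} →
    2 * bigCount j n ≤ τ′ j n
lemma7p2 j n j∣6@(divides r 6≡r*j) =
  at-most-half-exceed-√ {{m*n≢0 j m {{∣-nonZero j∣6}} {{∣-nonZero m∣n}}}}
    (*-monoʳ-≤ j (∣⇒≤ m∣n)) (λ d → j * cofactor m d) (divisorsWithGcd-unique j n) paired
  where
  open CoprimePart (coprimePart r n) renaming (part to m; part∣n to m∣n)

  r⊥j : Coprime r j
  r⊥j = squareFree⇒coprime (subst SquareFree 6≡r*j squareFree-6)

  gcd[m,6]∣j : gcd m 6 ∣ j
  gcd[m,6]∣j = coprime⇒gcd∣ part-coprime 6≡r*j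

  paired : ∀ {d} → d ∈ divisorsWithGcd j n →
    j * cofactor m d ∈ divisorsWithGcd j n × j * cofactor m d * d ≡ j * m
  paired {d} d∈S = cofactor-∈-divisorsWithGcd j∣6 m∣n gcd[m,6]∣j gcd≡j d∣m
                 , *cofactor-* j d∣m
    where
    d∣n : d ∣ n
    d∣n = proj₁ (∈-divisorsWithGcd⁻ {n = n} d∈S)
    gcd≡j : gcd d 6 ≡ j
    gcd≡j = proj₂ (∈-divisorsWithGcd⁻ {n = n} d∈S)
    d∣m : d ∣ m
    d∣m = part-greatest d∣n (gcd≡⇒coprime r⊥j (quotient-∣ j∣6) gcd≡j)
    instance
      d≢0 : NonZero d
      d≢0 = ∣-nonZero d∣n
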